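{- Let $d>0$ be an integer, let $N\geq d$ be an integer, and let $c\geq 0$ and $m>0$ be integers. Then $$\operatorname{div}(n,d)=\operatorname{div}(c\cdot n+c,\,m)\quad\text{and}\quad \operatorname{rem}(n,d)=\operatorname{div}(\operatorname{rem}(c\cdot n+c,\,m)\cdot d,\,m)$$ hold for all integers $n\in[0,N]$ if and only if $$\left(1-\frac{1}{N+1}\right)\frac1d\leq \frac cm<\frac1d.$$
   Context: For a non-negative real $x$ and a positive real $y$, define $\operatorname{div}(x,y)=\lfloor x/y\rfloor$ and $\operatorname{rem}(x,y)=x-\lfloor x/y\rfloor\cdot y$, where $\lfloor\cdot\rfloor$ is the floor function. -}

module Defs where

open import Data.Nat using (ℕ; NonZero)
open import Data.Nat.DivMod using (_/_; _%_)

div : (x y : ℕ) → .{{_ : NonZero y}} → ℕ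
div x y = x / y

rem : (x y : ℕ) → .{{_ : NonZero y}} → ℕ
rem x y = x % y

-- Writing k = c (n + 1), the pair (⌊k / m⌋, ⌊(k mod m) d / m⌋) is exactly the Euclidean
-- division of ⌊k d / m⌋ by d, so the two identities at n together say n = ⌊(n + 1) c d / m⌋,
-- i.e. n m ≤ (n + 1) c d < (n + 1) m.  The upper bound is c d < m whatever n is, and as
-- n / (n + 1) increases with n, the lower bound for all n ≤ N is its instance at n = N,
-- namely N / ((N + 1) d) ≤ c / m.
module Submission where

open import Defs
open import Data.Nat using (ℕ; suc; _+_; _*_; _≤_; _≥_; _>_; NonZero)
open import Data.Integer using (+_)
open import Data.Rational using (ℚ; 1ℚ) renaming (_/_ to _/ℚ_; _-_ to _-ℚ_; _*_ to _*ℚ_; _≤_ to _≤ℚ_; _<_ to _<ℚ_)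
open import Relation.Binary.PropositionalEquality using (_≡_)
open import Data.Product using (_×_)
open import Function.Bundles using (_⇔_)

open import Data.Nat using (_<_)
open import Data.Nat.Properties
open import Data.Nat.DivMod
open import Data.Nat.Tactic.RingSolver using (solve-∀)
open import Data.Integer as ℤ using (+≤+; +<+)
import Data.Integer.Properties as ℤ
open import Data.Rational as ℚ using (toℚᵘ)
open import Data.Rational.Properties
  using (toℚᵘ-fromℚᵘ; toℚᵘ-injective; toℚᵘ-homo-+; toℚᵘ-homo‿-; toℚᵘ-homo-*;
         toℚᵘ-mono-≤; toℚᵘ-cancel-≤; toℚᵘ-mono-<; toℚᵘ-cancel-<)
open import Data.Rational.Unnormalised as ℚᵘ using (_≃_; *≤*; *<*; *≡*) renaming (_/_ to _/ᵘ_)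
import Data.Rational.Unnormalised.Properties as ℚᵘ
open import Data.Product using (_,_; proj₁; proj₂)
open import Data.Product.Function.NonDependent.Propositional using (_×-⇔_)
open import Function.Bundles using (Equivalence; mk⇔)
open import Function.Properties.Equivalence using (⇔-setoid)
open import Level using (0ℓ)
open import Relation.Binary.PropositionalEquality using (refl; sym; trans; cong; cong₂; subst; subst₂)
import Relation.Binary.Reasoning.Setoid as SetoidReasoning

≡/⇔ : ∀ {n x m} .{{_ : NonZero m}} → n ≡ x / m ⇔ (n * m ≤ x × x < suc n * m)
≡/⇔ {n} {x} {m} = mk⇔ bounds exact
  where
  bounds : ∀ {n} → n ≡ x / m → n * m ≤ x × x < suc n * m
  bounds refl = m/n*n≤m x m
              , subst (_< suc (x / m) * m) (sym (m≡m%n+[m/n]*n x m))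
                      (+-monoˡ-< (x / m * m) (m%n<n x m))
  exact : n * m ≤ x × x < suc n * m → n ≡ x / m
  exact (lo , hi) = ≤-antisym (subst (_≤ x / m) (m*n/n≡m n m) (/-monoˡ-≤ m lo))
                              (≤-pred (m<n*o⇒m/o<n hi))

/-%-injective : ∀ {x y d} .{{_ : NonZero d}} → x / d ≡ y / d → x % d ≡ y % d → x ≡ y
/-%-injective {x} {y} {d} q≡ r≡ = begin
  x                 ≡⟨ m≡m%n+[m/n]*n x d ⟩
  x % d + x / d * d ≡⟨ cong₂ (λ r q → r + q * d) r≡ q≡ ⟩
  y % d + y / d * d ≡⟨ m≡m%n+[m/n]*n y d ⟨
  y                 ∎
  where open Relation.Binary.PropositionalEquality.≡-Reasoning

module _ (k d m : ℕ) .{{_ : NonZero d}} .{{_ : NonZero m}} where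
  private instance
    _ = m*n≢0 m d
    _ = m*n≢0 d m

  [k*d/m]/d≡k/m : k * d / m / d ≡ k / m
  [k*d/m]/d≡k/m = trans (m/n/o≡m/[n*o] (k * d) m d) (m*n/o*n≡m/o k d m)

  [k*d/m]%d≡[k%m*d]/m : k * d / m % d ≡ k % m * d / m
  [k*d/m]%d≡[k%m*d]/m = begin
    k * d / m % d       ≡⟨ m%[n*o]/o≡m/o%n (k * d) d m ⟨
    k * d % (d * m) / m ≡⟨ cong (_/ m) (%-congʳ (*-comm d m)) ⟩
    k * d % (m * d) / m ≡⟨ cong (_/ m) (m%n*o≡m*o%[n*o] k m d) ⟨
    k % m * d / m       ∎
    where open Relation.Binary.PropositionalEquality.≡-Reasoning

  quotRem≡⇔≡[k*d]/m : ∀ n → (n / d ≡ k / m × n % d ≡ k % m * d / m) ⇔ n ≡ k * d / m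
  quotRem≡⇔≡[k*d]/m n = mk⇔
    (λ (q≡ , r≡) → /-%-injective (trans q≡ (sym [k*d/m]/d≡k/m))
                                 (trans r≡ (sym [k*d/m]%d≡[k%m*d]/m)))
    (λ { refl → [k*d/m]/d≡k/m , [k*d/m]%d≡[k%m*d]/m })

n*m≤[1+n]*e-downwardClosed : ∀ {n N m e} → n ≤ N → N * m ≤ suc N * e → n * m ≤ suc n * e
n*m≤[1+n]*e-downwardClosed {n} {N} {m} {e} n≤N Nm≤ = *-cancelˡ-≤ (suc N) (begin
  suc N * (n * m)             ≡⟨ expand n N m ⟩
  n * (N * m) + n * m         ≤⟨ +-mono-≤ (*-monoʳ-≤ n Nm≤) (*-monoˡ-≤ m n≤N) ⟩
  n * (suc N * e) + N * m     ≤⟨ +-monoʳ-≤ (n * (suc N * e)) Nm≤ ⟩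
  n * (suc N * e) + suc N * e ≡⟨ collect n N e ⟩
  suc N * (suc n * e)         ∎)
  where
  open ≤-Reasoning
  expand : ∀ n N m → suc N * (n * m) ≡ n * (N * m) + n * m
  expand = solve-∀
  collect : ∀ n N e → n * (suc N * e) + suc N * e ≡ suc N * (suc n * e)
  collect = solve-∀

∀≤-cong : ∀ {N} {P Q : ℕ → Set} → (∀ n → P n ⇔ Q n) →
          (∀ n → n ≤ N → P n) ⇔ (∀ n → n ≤ N → Q n)
∀≤-cong P⇔Q = mk⇔ (λ h n n≤N → Equivalence.to (P⇔Q n) (h n n≤N))
                  (λ h n n≤N → Equivalence.from (P⇔Q n) (h n n≤N))

floorBounds⇔ : ∀ N m e →
  (∀ n → n ≤ N → n * m ≤ suc n * e × suc n * e < suc n * m) ⇔ (N * m ≤ suc N * e × e < m)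
floorBounds⇔ N m e = mk⇔
  (λ h → proj₁ (h N ≤-refl) , *-cancelˡ-< (suc N) e m (proj₂ (h N ≤-refl)))
  (λ (lo , hi) n n≤N → n*m≤[1+n]*e-downwardClosed n≤N lo , *-monoʳ-< (suc n) hi)

toℚᵘ-/ : ∀ i n .{{_ : NonZero n}} → toℚᵘ (i /ℚ n) ≃ i /ᵘ n
toℚᵘ-/ i (suc n) = toℚᵘ-fromℚᵘ (ℚᵘ.mkℚᵘ i n)

+/≤+/⇔ : ∀ a b n k .{{_ : NonZero n}} .{{_ : NonZero k}} →
         (+ a /ℚ n ≤ℚ + b /ℚ k) ⇔ (a * k ≤ b * n)
+/≤+/⇔ a b n@(suc _) k@(suc _) = mk⇔
  (λ p → cross (ℚᵘ.≤-respʳ-≃ (toℚᵘ-/ (+ b) k) (ℚᵘ.≤-respˡ-≃ (toℚᵘ-/ (+ a) n) (toℚᵘ-mono-≤ p))))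
  (λ p → toℚᵘ-cancel-≤ (ℚᵘ.≤-respʳ-≃ (ℚᵘ.≃-sym (toℚᵘ-/ (+ b) k))
           (ℚᵘ.≤-respˡ-≃ (ℚᵘ.≃-sym (toℚᵘ-/ (+ a) n))
             (*≤* (subst₂ ℤ._≤_ (ℤ.pos-* a k) (ℤ.pos-* b n) (+≤+ p))))))
  where
  cross : + a /ᵘ n ℚᵘ.≤ + b /ᵘ k → a * k ≤ b * n
  cross (*≤* p) = ℤ.drop‿+≤+ (subst₂ ℤ._≤_ (sym (ℤ.pos-* a k)) (sym (ℤ.pos-* b n)) p)

+/<+/⇔ : ∀ a b n k .{{_ : NonZero n}} .{{_ : NonZero k}} →
         (+ a /ℚ n <ℚ + b /ℚ k) ⇔ (a * k < b * n)
+/<+/⇔ a b n@(suc _) k@(suc _) = mk⇔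
  (λ p → cross (ℚᵘ.<-respʳ-≃ (toℚᵘ-/ (+ b) k) (ℚᵘ.<-respˡ-≃ (toℚᵘ-/ (+ a) n) (toℚᵘ-mono-< p))))
  (λ p → toℚᵘ-cancel-< (ℚᵘ.<-respʳ-≃ (ℚᵘ.≃-sym (toℚᵘ-/ (+ b) k))
           (ℚᵘ.<-respˡ-≃ (ℚᵘ.≃-sym (toℚᵘ-/ (+ a) n))
             (*<* (subst₂ ℤ._<_ (ℤ.pos-* a k) (ℤ.pos-* b n) (+<+ p))))))
  where
  cross : + a /ᵘ n ℚᵘ.< + b /ᵘ k → a * k < b * n
  cross (*<* p) = ℤ.drop‿+<+ (subst₂ ℤ._<_ (sym (ℤ.pos-* a k)) (sym (ℤ.pos-* b n)) p)

[1-1/[1+N]]*1/[1+d]≡N/[[1+N]*[1+d]] : ∀ N d →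
  (1ℚ -ℚ (+ 1 /ℚ suc N)) *ℚ (+ 1 /ℚ suc d) ≡ + N /ℚ (suc N * suc d)
[1-1/[1+N]]*1/[1+d]≡N/[[1+N]*[1+d]] N d = toℚᵘ-injective (begin
  toℚᵘ ((1ℚ -ℚ (+ 1 /ℚ suc N)) *ℚ (+ 1 /ℚ suc d))
    ≈⟨ toℚᵘ-homo-* (1ℚ -ℚ (+ 1 /ℚ suc N)) (+ 1 /ℚ suc d) ⟩
  toℚᵘ (1ℚ -ℚ (+ 1 /ℚ suc N)) ℚᵘ.* toℚᵘ (+ 1 /ℚ suc d)
    ≈⟨ ℚᵘ.*-cong toℚᵘ-1-1/[1+N] (toℚᵘ-/ (+ 1) (suc d)) ⟩
  X
    ≈⟨ *≡* (cong₂ ℤ._*_ ↥X≡N (sym ↧X≡[1+N]*[1+d])) ⟩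
  + N /ᵘ (suc N * suc d)
    ≈⟨ toℚᵘ-/ (+ N) (suc N * suc d) ⟨
  toℚᵘ (+ N /ℚ (suc N * suc d)) ∎)
  where
  open ℚᵘ.≃-Reasoning
  toℚᵘ-1-1/[1+N] : toℚᵘ (1ℚ -ℚ (+ 1 /ℚ suc N)) ≃ ℚᵘ.1ℚᵘ ℚᵘ.- (+ 1 /ᵘ suc N)
  toℚᵘ-1-1/[1+N] = ℚᵘ.≃-trans (toℚᵘ-homo-+ 1ℚ (ℚ.- (+ 1 /ℚ suc N)))
    (ℚᵘ.+-congʳ ℚᵘ.1ℚᵘ (ℚᵘ.≃-trans (toℚᵘ-homo‿- (+ 1 /ℚ suc N))
                                   (ℚᵘ.-‿cong (toℚᵘ-/ (+ 1) (suc N)))))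
  X = (ℚᵘ.1ℚᵘ ℚᵘ.- (+ 1 /ᵘ suc N)) ℚᵘ.* (+ 1 /ᵘ suc d)
  ↥X≡N : ℚᵘ.↥ X ≡ + N
  ↥X≡N = trans (ℤ.+◃n≡+n _) (cong +_ (trans (*-identityʳ _) (+-identityʳ N)))
  ↧X≡[1+N]*[1+d] : ℚᵘ.↧ X ≡ + (suc N * suc d)
  ↧X≡[1+N]*[1+d] = cong (λ z → + (suc z * suc d)) (+-identityʳ N)

theorem4 : (d N c m : ℕ) → .{{_ : NonZero d}} → .{{_ : NonZero m}} → N ≥ d →
    ((∀ (n : ℕ) → n ≤ N →
    (div n d ≡ div (c * n + c) m) × (rem n d ≡ div (rem (c * n + c) m * d) m))
    ⇔
    (((1ℚ -ℚ (+ 1 /ℚ suc N)) *ℚ (+ 1 /ℚ d) ≤ℚ (+ c /ℚ m)) × ((+ c /ℚ m) <ℚ (+ 1 /ℚ d))))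
theorem4 d@(suc d′) N c m@(suc _) _ = begin
  (∀ n → n ≤ N → (n / d ≡ (c * n + c) / m × n % d ≡ (c * n + c) % m * d / m))
    ≈⟨ ∀≤-cong pointwise ⟩
  (∀ n → n ≤ N → n * m ≤ suc n * (c * d) × suc n * (c * d) < suc n * m)
    ≈⟨ floorBounds⇔ N m (c * d) ⟩
  (N * m ≤ suc N * (c * d) × c * d < m)
    ≡⟨ cong₂ (λ x y → N * m ≤ x × c * d < y) (reassoc c N d) (sym (*-identityˡ m)) ⟩
  (N * m ≤ c * (suc N * d) × c * d < 1 * m)
    ≈⟨ +/≤+/⇔ N c (suc N * d) m ×-⇔ +/<+/⇔ c 1 m d ⟨
  (+ N /ℚ (suc N * d) ≤ℚ + c /ℚ m × + c /ℚ m <ℚ + 1 /ℚ d)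
    ≡⟨ cong (λ x → x ≤ℚ + c /ℚ m × + c /ℚ m <ℚ + 1 /ℚ d) ([1-1/[1+N]]*1/[1+d]≡N/[[1+N]*[1+d]] N d′) ⟨
  ((1ℚ -ℚ (+ 1 /ℚ suc N)) *ℚ (+ 1 /ℚ d) ≤ℚ + c /ℚ m × + c /ℚ m <ℚ + 1 /ℚ d) ∎
  where
  open SetoidReasoning (⇔-setoid 0ℓ)
  reassoc : ∀ c N d → suc N * (c * d) ≡ c * (suc N * d)
  reassoc = solve-∀
  factor : ∀ c n d → (c * n + c) * d ≡ suc n * (c * d)
  factor = solve-∀
  pointwise : ∀ n → (n / d ≡ (c * n + c) / m × n % d ≡ (c * n + c) % m * d / m) ⇔
                    (n * m ≤ suc n * (c * d) × suc n * (c * d) < suc n * m)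
  pointwise n = begin
    (n / d ≡ (c * n + c) / m × n % d ≡ (c * n + c) % m * d / m)
      ≈⟨ quotRem≡⇔≡[k*d]/m (c * n + c) d m n ⟩
    n ≡ (c * n + c) * d / m
      ≈⟨ ≡/⇔ ⟩
    (n * m ≤ (c * n + c) * d × (c * n + c) * d < suc n * m)
      ≡⟨ cong (λ x → n * m ≤ x × x < suc n * m) (factor c n d) ⟩
    (n * m ≤ suc n * (c * d) × suc n * (c * d) < suc n * m) ∎
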